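{- For all $a,b,r,\delta\in\mathbb{C}$ and all $0\le k\le n$, \[(\delta)^{\underline k,b}\,S_{n,k}(a,-b;r+\delta)=\sum_{j=k}^n\binom jk(\delta)^{\underline j,b}\,S_{n,j}(a,b;r).\]
   Context: For complex parameters $(\alpha,\beta,\gamma;\alpha',\beta',\gamma')$, the GKP triangle is the unique array $T_{n,k}$, $0\le k\le n$ ($T_{n,k}=0$ if $k<0$ or $k>n$), with $T_{0,0}=1$ and $T_{n+1,k+1}=[\alpha n+\beta(k+1)+\gamma]T_{n,k+1}+[\alpha' n+\beta' k+\gamma']T_{n,k}$ for $n\ge0$, $k\ge-1$. The generalized Stirling (Hsu–Shiue) numbers $S_{n,k}(a,b;r)$ form the GKP triangle with parameters $(-a,b,r;0,0,1)$. $(x)^{\underline m,b}=x(x-b)\cdots(x-(m-1)b)$, equal to $1$ for $m=0$. -}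

module Defs where

open import Level using (Level)
open import Data.Nat as ℕ using (ℕ; zero; suc; _∸_)
open import Data.Nat.Combinatorics using (_C_)
open import Algebra.Bundles using (CommutativeRing)

module _ {c ℓ : Level} (R : CommutativeRing c ℓ) where
  open CommutativeRing R hiding (zero)

  fromℕ : ℕ → Carrier
  fromℕ zero    = 0#
  fromℕ (suc n) = 1# + fromℕ n

  sumN : ℕ → (ℕ → Carrier) → Carrier
  sumN zero    f = 0#
  sumN (suc m) f = sumN m f + f m

  -- sumFromTo k n f = Σ_{j=k}^{n} f j   (empty, i.e. 0#, if n < k)
  sumFromTo : ℕ → ℕ → (ℕ → Carrier) → Carrier
  sumFromTo k n f = sumN (suc n ∸ k) (λ i → f (k ℕ.+ i))

  fallingB : Carrier → Carrier → ℕ → Carrier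
  fallingB x b zero    = 1#
  fallingB x b (suc m) = fallingB x b m * (x - fromℕ m * b)

  -- GKP triangle T_{n,k} with parameters (α,β,γ;α',β',γ'), k ≥ 0.
  -- T_{n,-1} = 0, so for target column 0 the recurrence reads
  -- T_{n+1,0} = [α n + β·0 + γ] T_{n,0}.
  GKP : (α β γ α' β' γ' : Carrier) → ℕ → ℕ → Carrier
  GKP α β γ α' β' γ' zero    zero    = 1#
  GKP α β γ α' β' γ' zero    (suc k) = 0#
  GKP α β γ α' β' γ' (suc n) zero    =
    (α * fromℕ n + β * fromℕ 0 + γ) * GKP α β γ α' β' γ' n zero
  GKP α β γ α' β' γ' (suc n) (suc k) =
    (α * fromℕ n + β * fromℕ (suc k) + γ) * GKP α β γ α' β' γ' n (suc k)
    + (α' * fromℕ n + β' * fromℕ k + γ') * GKP α β γ α' β' γ' n k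

  HsuShiue : (a b r : Carrier) → ℕ → ℕ → Carrier
  HsuShiue a b r = GKP (- a) b r 0# 0# 1#

  binom : ℕ → ℕ → Carrier
  binom j k = fromℕ (j C k)

{-# OPTIONS --safe #-}
module Submission where

-- Both sides, as arrays in (n, k), satisfy
--   u(n+1,k) = (-a n - b k + r + δ) u(n,k) + (δ - (k-1) b) u(n,k-1)
-- and agree at n = 0. For the left side this is the recurrence of S(a,-b;r+δ) multiplied by the
-- falling factorial; for the binomial sum it follows from the recurrence of S(a,b;r) by shifting
-- the summation index, Pascal's rule and the absorption identity k C(j,k) + (k-1) C(j,k-1) = j C(j,k-1).

open import Defs
open import Level using (Level)
open import Algebra.Bundles using (CommutativeRing)

import Data.Nat as ℕ
open import Data.Nat using (ℕ; zero; suc; _∸_; _≤_; _<_; s≤s; z≤n)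
import Data.Nat.Properties as ℕₚ
open ℕₚ using (m+[n∸m]≡n; m≤n⇒m≤1+n; m<n⇒m<1+n; n<1+n)
open import Data.Nat.Combinatorics using (_C_; k>n⇒nCk≡0; nC1≡n; nCk+nC[k+1]≡[n+1]C[k+1])
open import Data.Nat.Solver using (module +-*-Solver)
open import Relation.Binary.PropositionalEquality as ≡ using (_≡_)

[k+1]*nC[k+1]+k*nCk≡n*nCk : ∀ n k → suc k ℕ.* (n C suc k) ℕ.+ k ℕ.* (n C k) ≡ n ℕ.* (n C k)
[k+1]*nC[k+1]+k*nCk≡n*nCk zero    zero    = ≡.refl
[k+1]*nC[k+1]+k*nCk≡n*nCk zero    (suc k) = ≡.cong₂ ℕ._+_ (ℕₚ.*-zeroʳ (suc (suc k))) (ℕₚ.*-zeroʳ (suc k))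
[k+1]*nC[k+1]+k*nCk≡n*nCk (suc n) zero    = begin
  1 ℕ.* (suc n C 1) ℕ.+ 0  ≡⟨ ℕₚ.+-identityʳ _ ⟩
  1 ℕ.* (suc n C 1)        ≡⟨ ℕₚ.*-identityˡ _ ⟩
  suc n C 1                ≡⟨ nC1≡n (suc n) ⟩
  suc n                    ≡⟨ ℕₚ.*-identityʳ (suc n) ⟨
  suc n ℕ.* 1              ∎
  where open ≡.≡-Reasoning
[k+1]*nC[k+1]+k*nCk≡n*nCk (suc n) (suc k) = begin
  suc (suc k) ℕ.* (suc n C suc (suc k)) ℕ.+ suc k ℕ.* (suc n C suc k)
    ≡⟨ ≡.cong₂ (λ u v → suc (suc k) ℕ.* u ℕ.+ suc k ℕ.* v)
         (≡.sym (nCk+nC[k+1]≡[n+1]C[k+1] n (suc k))) (≡.sym (nCk+nC[k+1]≡[n+1]C[k+1] n k)) ⟩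
  suc (suc k) ℕ.* (c₁ ℕ.+ c₂) ℕ.+ suc k ℕ.* (c₀ ℕ.+ c₁)
    ≡⟨ solve 4 (λ k c₀ c₁ c₂ → (con 2 :+ k) :* (c₁ :+ c₂) :+ (con 1 :+ k) :* (c₀ :+ c₁)
                  := ((con 2 :+ k) :* c₂ :+ (con 1 :+ k) :* c₁) :+ ((con 1 :+ k) :* c₁ :+ k :* c₀) :+ c₁ :+ c₀)
               ≡.refl k c₀ c₁ c₂ ⟩
  (suc (suc k) ℕ.* c₂ ℕ.+ suc k ℕ.* c₁) ℕ.+ (suc k ℕ.* c₁ ℕ.+ k ℕ.* c₀) ℕ.+ c₁ ℕ.+ c₀
    ≡⟨ ≡.cong₂ (λ u v → u ℕ.+ v ℕ.+ c₁ ℕ.+ c₀)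
         ([k+1]*nC[k+1]+k*nCk≡n*nCk n (suc k)) ([k+1]*nC[k+1]+k*nCk≡n*nCk n k) ⟩
  n ℕ.* c₁ ℕ.+ n ℕ.* c₀ ℕ.+ c₁ ℕ.+ c₀
    ≡⟨ solve 3 (λ n c₀ c₁ → n :* c₁ :+ n :* c₀ :+ c₁ :+ c₀ := (con 1 :+ n) :* (c₀ :+ c₁)) ≡.refl n c₀ c₁ ⟩
  suc n ℕ.* (c₀ ℕ.+ c₁)
    ≡⟨ ≡.cong (suc n ℕ.*_) (nCk+nC[k+1]≡[n+1]C[k+1] n k) ⟩
  suc n ℕ.* (suc n C suc k) ∎
  where
  open ≡.≡-Reasoning
  open +-*-Solver
  c₀ c₁ c₂ : ℕ
  c₀ = n C k
  c₁ = n C suc k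
  c₂ = n C suc (suc k)

module _ {c ℓ : Level} (R : CommutativeRing c ℓ) where
  open CommutativeRing R hiding (zero)
  open import Algebra.Properties.Ring ring using (-‿distribʳ-*)
  open import Relation.Binary.Reasoning.Setoid setoid
  open import Algebra.Solver.Ring.NaturalCoefficients.Default commutativeSemiring
    using (solve; _:=_; _:+_; _:*_; con)

  x≈y+z*w⇒x≈y : ∀ {x y z w} → z ≈ 0# → x ≈ y + z * w → x ≈ y
  x≈y+z*w⇒x≈y {x} {y} {z} {w} z≈0 x≈y+zw = begin
    x          ≈⟨ x≈y+zw ⟩
    y + z * w  ≈⟨ +-congˡ (trans (*-congʳ z≈0) (zeroˡ w)) ⟩
    y + 0#     ≈⟨ +-identityʳ y ⟩
    y          ∎

  fromℕ-+ : ∀ m n → fromℕ R (m ℕ.+ n) ≈ fromℕ R m + fromℕ R n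
  fromℕ-+ zero    n = sym (+-identityˡ _)
  fromℕ-+ (suc m) n = trans (+-congˡ (fromℕ-+ m n)) (sym (+-assoc _ _ _))

  fromℕ-* : ∀ m n → fromℕ R (m ℕ.* n) ≈ fromℕ R m * fromℕ R n
  fromℕ-* zero    n = sym (zeroˡ _)
  fromℕ-* (suc m) n = begin
    fromℕ R (n ℕ.+ m ℕ.* n)             ≈⟨ fromℕ-+ n (m ℕ.* n) ⟩
    fromℕ R n + fromℕ R (m ℕ.* n)       ≈⟨ +-cong (sym (*-identityˡ _)) (fromℕ-* m n) ⟩
    1# * fromℕ R n + fromℕ R m * fromℕ R n ≈⟨ sym (distribʳ _ _ _) ⟩
    (1# + fromℕ R m) * fromℕ R n        ∎

  sumN-cong : ∀ m {f g} → (∀ i → f i ≈ g i) → sumN R m f ≈ sumN R m g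
  sumN-cong zero    f≈g = refl
  sumN-cong (suc m) f≈g = +-cong (sumN-cong m f≈g) (f≈g m)

  sumN-zero : ∀ m → sumN R m (λ _ → 0#) ≈ 0#
  sumN-zero zero    = refl
  sumN-zero (suc m) = trans (+-identityʳ _) (sumN-zero m)

  sumN-+ : ∀ m f g → sumN R m (λ i → f i + g i) ≈ sumN R m f + sumN R m g
  sumN-+ zero    f g = sym (+-identityˡ _)
  sumN-+ (suc m) f g = trans (+-congʳ (sumN-+ m f g))
    (solve 4 (λ s t x y → (s :+ t) :+ (x :+ y) := (s :+ x) :+ (t :+ y)) refl _ _ _ _)

  *-distribˡ-sumN : ∀ m x f → x * sumN R m f ≈ sumN R m (λ i → x * f i)
  *-distribˡ-sumN zero    x f = zeroʳ _
  *-distribˡ-sumN (suc m) x f = trans (distribˡ _ _ _) (+-congʳ (*-distribˡ-sumN m x f))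

  sumN-suc : ∀ m f → sumN R (suc m) f ≈ f 0 + sumN R m (λ i → f (suc i))
  sumN-suc zero    f = +-comm _ _
  sumN-suc (suc m) f = trans (+-congʳ (sumN-suc m f)) (+-assoc _ _ _)

  sumN-dropInitialZeros : ∀ k m f → (∀ i → i < k → f i ≈ 0#) →
                          sumN R (k ℕ.+ m) f ≈ sumN R m (λ i → f (k ℕ.+ i))
  sumN-dropInitialZeros zero    m f _      = refl
  sumN-dropInitialZeros (suc k) m f f<k≈0 = begin
    sumN R (suc (k ℕ.+ m)) f                             ≈⟨ sumN-suc (k ℕ.+ m) f ⟩
    f 0 + sumN R (k ℕ.+ m) (λ i → f (suc i))             ≈⟨ +-congʳ (f<k≈0 0 (s≤s z≤n)) ⟩
    0# + sumN R (k ℕ.+ m) (λ i → f (suc i))              ≈⟨ +-identityˡ _ ⟩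
    sumN R (k ℕ.+ m) (λ i → f (suc i))                   ≈⟨ sumN-dropInitialZeros k m (λ i → f (suc i))
                                                              (λ i i<k → f<k≈0 (suc i) (s≤s i<k)) ⟩
    sumN R m (λ i → f (suc (k ℕ.+ i)))                   ∎

  sumN≈sumFromTo : ∀ {k n} g → k ≤ n → (∀ j → j < k → g j ≈ 0#) →
                   sumN R (suc n) g ≈ sumFromTo R k n g
  sumN≈sumFromTo {k} {n} g k≤n g<k≈0 = begin
    sumN R (suc n) g              ≈⟨ reflexive (≡.cong (λ m → sumN R m g) (≡.sym (m+[n∸m]≡n k≤1+n))) ⟩
    sumN R (k ℕ.+ (suc n ∸ k)) g  ≈⟨ sumN-dropInitialZeros k (suc n ∸ k) g g<k≈0 ⟩
    sumFromTo R k n g             ∎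
    where
    k≤1+n : k ≤ suc n
    k≤1+n = m≤n⇒m≤1+n k≤n

  shift : (ℕ → Carrier) → ℕ → Carrier
  shift g zero    = 0#
  shift g (suc k) = g k

  shift-cong : ∀ {g h} → (∀ i → g i ≈ h i) → ∀ k → shift g k ≈ shift h k
  shift-cong g≈h zero    = refl
  shift-cong g≈h (suc k) = g≈h k

  shift-*ʳ : ∀ g x k → shift g k * x ≈ shift (λ i → g i * x) k
  shift-*ʳ g x zero    = zeroˡ x
  shift-*ʳ g x (suc k) = refl

  sumN-shift : ∀ m (g : ℕ → ℕ → Carrier) k →
               sumN R m (λ j → shift (λ i → g i j) k) ≈ shift (λ i → sumN R m (g i)) k
  sumN-shift m g zero    = sumN-zero m
  sumN-shift m g (suc k) = refl

  shift-affine-* : ∀ x y g k → shift (λ i → (x - fromℕ R i * y) * g i) k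
                               ≈ x * shift g k + (- y) * shift (λ i → fromℕ R i * g i) k
  shift-affine-* x y g zero    = sym (trans (+-cong (zeroʳ x) (zeroʳ (- y))) (+-identityʳ 0#))
  shift-affine-* x y g (suc k) = begin
    (x + - (I * y)) * g k        ≈⟨ *-congʳ (+-congˡ (-‿distribʳ-* I y)) ⟩
    (x + I * - y) * g k          ≈⟨ solve 4 (λ x I ȳ G → (x :+ I :* ȳ) :* G := x :* G :+ ȳ :* (I :* G))
                                      refl x I (- y) (g k) ⟩
    x * g k + (- y) * (I * g k)  ∎
    where I = fromℕ R k

  fallingB-*-shift : ∀ x y g k → fallingB R x y k * shift g k
                     ≈ shift (λ i → (x - fromℕ R i * y) * (fallingB R x y i * g i)) k
  fallingB-*-shift x y g zero    = zeroʳ _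
  fallingB-*-shift x y g (suc k) = trans (*-congʳ (*-comm _ _)) (*-assoc _ _ _)

  binom-vanish : ∀ {j k} → j < k → binom R j k ≈ 0#
  binom-vanish j<k = reflexive (≡.cong (fromℕ R) (k>n⇒nCk≡0 j<k))

  binom-pascal : ∀ j k → binom R (suc j) k ≈ binom R j k + shift (binom R j) k
  binom-pascal j zero    = sym (+-identityʳ _)
  binom-pascal j (suc k) = begin
    fromℕ R (suc j C suc k)              ≈⟨ reflexive (≡.cong (fromℕ R) (≡.sym (nCk+nC[k+1]≡[n+1]C[k+1] j k))) ⟩
    fromℕ R (j C k ℕ.+ j C suc k)        ≈⟨ fromℕ-+ (j C k) (j C suc k) ⟩
    binom R j k + binom R j (suc k)      ≈⟨ +-comm _ _ ⟩
    binom R j (suc k) + binom R j k      ∎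

  binom-absorb : ∀ j k → fromℕ R k * binom R j k + shift (λ i → fromℕ R i * binom R j i) k
                         ≈ fromℕ R j * shift (binom R j) k
  binom-absorb j zero    = trans (+-identityʳ _) (trans (zeroˡ _) (sym (zeroʳ _)))
  binom-absorb j (suc k) = begin
    fromℕ R (suc k) * fromℕ R (j C suc k) + fromℕ R k * fromℕ R (j C k)
      ≈⟨ sym (+-cong (fromℕ-* (suc k) (j C suc k)) (fromℕ-* k (j C k))) ⟩
    fromℕ R (suc k ℕ.* (j C suc k)) + fromℕ R (k ℕ.* (j C k))
      ≈⟨ sym (fromℕ-+ (suc k ℕ.* (j C suc k)) (k ℕ.* (j C k))) ⟩
    fromℕ R (suc k ℕ.* (j C suc k) ℕ.+ k ℕ.* (j C k))
      ≈⟨ reflexive (≡.cong (fromℕ R) ([k+1]*nC[k+1]+k*nCk≡n*nCk j k)) ⟩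
    fromℕ R (j ℕ.* (j C k))
      ≈⟨ fromℕ-* j (j C k) ⟩
    fromℕ R j * fromℕ R (j C k) ∎

  GKP-above-diagonal : ∀ α β γ α' β' γ' {n j} → n < j → GKP R α β γ α' β' γ' n j ≈ 0#
  GKP-above-diagonal α β γ α' β' γ' {zero}  {suc j} _           = refl
  GKP-above-diagonal α β γ α' β' γ' {suc n} {suc j} (s≤s n<j) = begin
    u * T n (suc j) + u' * T n j  ≈⟨ +-cong (*-congˡ (GKP-above-diagonal α β γ α' β' γ' (m<n⇒m<1+n n<j)))
                                            (*-congˡ (GKP-above-diagonal α β γ α' β' γ' n<j)) ⟩
    u * 0# + u' * 0#              ≈⟨ +-cong (zeroʳ u) (zeroʳ u') ⟩
    0# + 0#                       ≈⟨ +-identityʳ 0# ⟩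
    0#                            ∎
    where
    T : ℕ → ℕ → Carrier
    T  = GKP R α β γ α' β' γ'
    u u' : Carrier
    u  = α * fromℕ R n + β * fromℕ R (suc j) + γ
    u' = α' * fromℕ R n + β' * fromℕ R j + γ'

  weight : (a b r : Carrier) → ℕ → ℕ → Carrier
  weight a b r n k = - a * fromℕ R n + b * fromℕ R k + r

  HsuShiue-suc : ∀ a b r n k → HsuShiue R a b r (suc n) k
                 ≈ weight a b r n k * HsuShiue R a b r n k + shift (HsuShiue R a b r n) k
  HsuShiue-suc a b r n zero    = sym (+-identityʳ _)
  HsuShiue-suc a b r n (suc k) = +-congˡ (trans (*-congʳ unit-weight) (*-identityˡ _))
    where
    unit-weight : 0# * fromℕ R n + 0# * fromℕ R k + 1# ≈ 1#
    unit-weight = solve 2 (λ N K → con 0 :* N :+ con 0 :* K :+ con 1 := con 1) refl (fromℕ R n) (fromℕ R k)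

  sumN-HsuShiue-suc : ∀ a b r n (h : ℕ → Carrier) →
    sumN R (suc (suc n)) (λ j → h j * HsuShiue R a b r (suc n) j)
      ≈ sumN R (suc n) (λ j → (h j * weight a b r n j + h (suc j)) * HsuShiue R a b r n j)
  sumN-HsuShiue-suc a b r n h = begin
    sumN R (suc (suc n)) (λ j → h j * S (suc n) j)
      ≈⟨ sumN-cong (suc (suc n)) (λ j → trans (*-congˡ (HsuShiue-suc a b r n j)) (distribˡ _ _ _)) ⟩
    sumN R (suc (suc n)) (λ j → h j * (w j * S n j) + h j * shift (S n) j)
      ≈⟨ sumN-+ (suc (suc n)) _ _ ⟩
    sumN R (suc (suc n)) (λ j → h j * (w j * S n j)) + sumN R (suc (suc n)) (λ j → h j * shift (S n) j)
      ≈⟨ +-cong (trans (+-congˡ diagonal-vanishes) (+-identityʳ _))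
                (trans (sumN-suc (suc n) _) (trans (+-congʳ (zeroʳ (h 0))) (+-identityˡ _))) ⟩
    sumN R (suc n) (λ j → h j * (w j * S n j)) + sumN R (suc n) (λ j → h (suc j) * S n j)
      ≈⟨ sym (sumN-+ (suc n) _ _) ⟩
    sumN R (suc n) (λ j → h j * (w j * S n j) + h (suc j) * S n j)
      ≈⟨ sumN-cong (suc n) (λ j → trans (+-congʳ (sym (*-assoc _ _ _))) (sym (distribʳ _ _ _))) ⟩
    sumN R (suc n) (λ j → (h j * w j + h (suc j)) * S n j) ∎
    where
    S : ℕ → ℕ → Carrier
    S = HsuShiue R a b r
    w : ℕ → Carrier
    w = weight a b r n
    diagonal-vanishes : h (suc n) * (w (suc n) * S n (suc n)) ≈ 0#
    diagonal-vanishes = trans (*-congˡ (trans (*-congˡ (GKP-above-diagonal _ _ _ _ _ _ (n<1+n n))) (zeroʳ _)))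
                              (zeroʳ _)

  Recurrence : (ℕ → ℕ → Carrier) → (ℕ → Carrier) → (ℕ → ℕ → Carrier) → Set ℓ
  Recurrence w v T = ∀ n k → T (suc n) k ≈ w n k * T n k + shift (λ i → v i * T n i) k

  recurrence-unique : ∀ {w v T U} → Recurrence w v T → Recurrence w v U →
                      (∀ k → T 0 k ≈ U 0 k) → ∀ n k → T n k ≈ U n k
  recurrence-unique T-rec U-rec T₀≈U₀ zero    k = T₀≈U₀ k
  recurrence-unique {T = T} {U} T-rec U-rec T₀≈U₀ (suc n) k =
    trans (T-rec n k) (trans (+-cong (*-congˡ (T≈U n k)) (shift-cong (λ i → *-congˡ (T≈U n i)) k))
                             (sym (U-rec n k)))
    where
    T≈U : ∀ n k → T n k ≈ U n k
    T≈U = recurrence-unique T-rec U-rec T₀≈U₀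

  module _ (a b r δ : Carrier) where
    private
      f d : ℕ → Carrier
      f = fallingB R δ b
      d i = δ - fromℕ R i * b
      S S′ w w′ : ℕ → ℕ → Carrier
      S  = HsuShiue R a b r
      S′ = HsuShiue R a (- b) (r + δ)
      w  = weight a b r
      w′ = weight a (- b) (r + δ)

    fallingB*HsuShiue-recurrence : Recurrence w′ d (λ n k → f k * S′ n k)
    fallingB*HsuShiue-recurrence n k = begin
      f k * S′ (suc n) k                           ≈⟨ *-congˡ (HsuShiue-suc a (- b) (r + δ) n k) ⟩
      f k * (w′ n k * S′ n k + shift (S′ n) k)     ≈⟨ distribˡ _ _ _ ⟩
      f k * (w′ n k * S′ n k) + f k * shift (S′ n) k
        ≈⟨ +-cong (trans (sym (*-assoc _ _ _)) (trans (*-congʳ (*-comm _ _)) (*-assoc _ _ _)))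
                  (fallingB-*-shift δ b (S′ n) k) ⟩
      w′ n k * (f k * S′ n k) + shift (λ i → d i * (f i * S′ n i)) k ∎

    binomial-coefficient-identity : ∀ n j k →
      binom R j k * f j * w n j + binom R (suc j) k * f (suc j)
        ≈ w′ n k * (binom R j k * f j) + shift (λ i → d i * binom R j i) k * f j
    -- The semiring solver sees - b as an independent atom, so the identity is established
    -- up to the multiple (b + - b) * (J * X * F), which is then discarded.
    binomial-coefficient-identity n j k = x≈y+z*w⇒x≈y (-‿inverseʳ b) (begin
      X * F * w n j + binom R (suc j) k * (F * (δ - J * b))
        ≈⟨ +-congˡ (*-cong (binom-pascal j k) (*-congˡ (+-congˡ (-‿distribʳ-* J b)))) ⟩
      X * F * w n j + (X + Y) * (F * (δ + J * - b))
        ≈⟨ solve 10 (λ A N b b̄ J r δ F X Y →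
              X :* F :* (A :* N :+ b :* J :+ r) :+ (X :+ Y) :* (F :* (δ :+ J :* b̄))
              := (X :* F :* (A :* N :+ r) :+ δ :* X :* F :+ δ :* Y :* F) :+ b̄ :* F :* (J :* Y)
                 :+ (b :+ b̄) :* (J :* X :* F))
            refl (- a) N b (- b) J r δ F X Y ⟩
      M + - b * F * (J * Y) + (b + - b) * (J * X * F)
        ≈⟨ +-congʳ (+-congˡ (*-congˡ (sym (binom-absorb j k)))) ⟩
      M + - b * F * (K * X + Z) + (b + - b) * (J * X * F)
        ≈⟨ +-congʳ (solve 10 (λ A N b̄ K r δ F X Y Z →
              (X :* F :* (A :* N :+ r) :+ δ :* X :* F :+ δ :* Y :* F) :+ b̄ :* F :* (K :* X :+ Z)
              := (A :* N :+ b̄ :* K :+ (r :+ δ)) :* (X :* F) :+ (δ :* Y :+ b̄ :* Z) :* F)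
            refl (- a) N (- b) K r δ F X Y Z) ⟩
      w′ n k * (X * F) + (δ * Y + - b * Z) * F + (b + - b) * (J * X * F)
        ≈⟨ +-congʳ (+-congˡ (*-congʳ (sym (shift-affine-* δ b (binom R j) k)))) ⟩
      w′ n k * (X * F) + shift (λ i → d i * binom R j i) k * F + (b + - b) * (J * X * F) ∎)
      where
      F N J K X Y Z M : Carrier
      F = f j
      N = fromℕ R n
      J = fromℕ R j
      K = fromℕ R k
      X = binom R j k
      Y = shift (binom R j) k
      Z = shift (λ i → fromℕ R i * binom R j i) k
      M = X * F * (- a * N + r) + δ * X * F + δ * Y * F

    binomial-sum : ℕ → ℕ → Carrier
    binomial-sum n k = sumN R (suc n) (λ j → binom R j k * f j * S n j)

    binomial-sum-recurrence : Recurrence w′ d binomial-sum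
    binomial-sum-recurrence n k = begin
      sumN R (suc (suc n)) (λ j → h j * S (suc n) j)
        ≈⟨ sumN-HsuShiue-suc a b r n h ⟩
      sumN R (suc n) (λ j → (h j * w n j + h (suc j)) * S n j)
        ≈⟨ sumN-cong (suc n) (λ j → trans (*-congʳ (binomial-coefficient-identity n j k))
                                          (distribʳ _ _ _)) ⟩
      sumN R (suc n) (λ j → w′ n k * h j * S n j + e j * f j * S n j)
        ≈⟨ sumN-+ (suc n) _ _ ⟩
      sumN R (suc n) (λ j → w′ n k * h j * S n j) + sumN R (suc n) (λ j → e j * f j * S n j)
        ≈⟨ +-cong (trans (sumN-cong (suc n) (λ j → *-assoc _ _ _)) (sym (*-distribˡ-sumN (suc n) _ _)))
                  shifted-sum ⟩
      w′ n k * binomial-sum n k + shift (λ i → d i * binomial-sum n i) k ∎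
      where
      h e : ℕ → Carrier
      h j = binom R j k * f j
      e j = shift (λ i → d i * binom R j i) k
      shifted-sum : sumN R (suc n) (λ j → e j * f j * S n j) ≈ shift (λ i → d i * binomial-sum n i) k
      shifted-sum = begin
        sumN R (suc n) (λ j → e j * f j * S n j)
          ≈⟨ sumN-cong (suc n) (λ j → trans (*-congʳ (shift-*ʳ _ _ k)) (shift-*ʳ _ _ k)) ⟩
        sumN R (suc n) (λ j → shift (λ i → d i * binom R j i * f j * S n j) k)
          ≈⟨ sumN-shift (suc n) (λ i j → d i * binom R j i * f j * S n j) k ⟩
        shift (λ i → sumN R (suc n) (λ j → d i * binom R j i * f j * S n j)) k
          ≈⟨ shift-cong (λ i → trans (sumN-cong (suc n) (λ j → trans (*-congʳ (*-assoc _ _ _))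
                                                                      (*-assoc _ _ _)))
                                     (sym (*-distribˡ-sumN (suc n) (d i) _))) k ⟩
        shift (λ i → d i * binomial-sum n i) k ∎

    fallingB*HsuShiue≈binomial-sum : ∀ n k → f k * S′ n k ≈ binomial-sum n k
    fallingB*HsuShiue≈binomial-sum =
      recurrence-unique fallingB*HsuShiue-recurrence binomial-sum-recurrence initial-row
      where
      initial-row : ∀ k → f k * S′ 0 k ≈ binomial-sum 0 k
      initial-row k = trans (lhs k) (sym (trans (+-identityˡ _) (trans (*-identityʳ _) (*-identityʳ _))))
        where
        lhs : ∀ k → f k * S′ 0 k ≈ binom R 0 k
        lhs zero    = trans (*-identityˡ 1#) (sym (+-identityʳ 1#))
        lhs (suc k) = trans (zeroʳ _) (sym (binom-vanish {k = suc k} (s≤s z≤n)))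

theorem4p13 : {c ℓ : Level} (R : CommutativeRing c ℓ) →
    let open CommutativeRing R in
    (a b r δ : Carrier) (n k : ℕ) → k ≤ n →
    fallingB R δ b k * HsuShiue R a (- b) (r + δ) n k
    ≈ sumFromTo R k n (λ j → binom R j k * fallingB R δ b j * HsuShiue R a b r n j)
theorem4p13 R a b r δ n k k≤n =
  trans (fallingB*HsuShiue≈binomial-sum R a b r δ n k) (sumN≈sumFromTo R _ k≤n terms-below-k-vanish)
  where
  open CommutativeRing R
  terms-below-k-vanish : ∀ j → j < k → binom R j k * fallingB R δ b j * HsuShiue R a b r n j ≈ 0#
  terms-below-k-vanish j j<k = trans (*-congʳ (trans (*-congʳ (binom-vanish R j<k)) (zeroˡ _))) (zeroˡ _)
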